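{- For any integer $k\ge2$, with $\mathcal{B}=\mathbb{Z}_k^2$, there is a unitary matrix $K:\mathcal{B}^{\otimes3}\to\mathcal{B}^{\otimes3}$ (i.e. an $8\times8$ matrix over $\mathbb{Z}_k$ with $K^{\mathsf T}K=I$) such that for some $|\gamma\rangle\in\mathcal{B}^{\otimes2}$, $K|000\rangle=|\gamma\rangle\otimes|0\rangle+(|0\rangle+|1\rangle)\otimes|11\rangle.$
   Context: $\mathcal{B}^{\otimes n}=\mathbb{Z}_k^{\{0,1\}^n}$ has standard basis $|x\rangle$, $x\in\{0,1\}^n$, and tensor products are Kronecker products; over $\mathbb{Z}_k$ the conjugation is trivial, so unitarity means $K^{\mathsf T}K=I$. -}

module Defs where

open import Data.Nat using (ℕ)
open import Data.Fin using (Fin; zero; suc)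
open import Data.Integer using (ℤ; _-_; _*_; _+_; +_; 0ℤ; 1ℤ)
open import Data.Integer.Divisibility using (_∣_)
open import Data.Product using (_×_)

-- Elements of ℤ_k are represented by integers; equality in ℤ_k is congruence mod k.
_≡[mod_]_ : ℤ → ℕ → ℤ → Set
a ≡[mod k ] b = (+ k) ∣ (a - b)

∑ : (n : ℕ) → (Fin n → ℤ) → ℤ
∑ ℕ.zero f = 0ℤ
∑ (ℕ.suc n) f = f zero + ∑ n (λ i → f (suc i))

Mat : ℕ → Set
Mat n = Fin n → Fin n → ℤ

Vec' : ℕ → Set
Vec' n = Fin n → ℤ

δ : {n : ℕ} → Fin n → Fin n → ℤ
δ zero zero = 1ℤ
δ zero (suc j) = 0ℤ
δ (suc i) zero = 0ℤ
δ (suc i) (suc j) = δ i j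

Unitary : (k n : ℕ) → Mat n → Set
Unitary k n K = (i j : Fin n) → ∑ n (λ l → K l i * K l j) ≡[mod k ] δ i j

-- K applied to the basis vector |x⟩ is the column x of K
-- Basis of B^{⊗2} = ℤ_k^4 indexed by Fin 4 ≅ {0,1}^2 (index 2x₁+x₂),
-- basis of B^{⊗3} by Fin 8 (index 4x₁+2x₂+x₃), matching Kronecker products.
-- The target vector |γ⟩⊗|0⟩ + (|0⟩+|1⟩)⊗|11⟩ in ℤ_k^8:
target : Vec' 4 → Vec' 8
target γ zero = γ zero                                   -- 000
target γ (suc zero) = 0ℤ                                 -- 001
target γ (suc (suc zero)) = γ (suc zero)                 -- 010
target γ (suc (suc (suc zero))) = 1ℤ                     -- 011
target γ (suc (suc (suc (suc zero)))) = γ (suc (suc zero))          -- 100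
target γ (suc (suc (suc (suc (suc zero))))) = 0ℤ                    -- 101
target γ (suc (suc (suc (suc (suc (suc zero)))))) = γ (suc (suc (suc zero)))  -- 110
target γ (suc (suc (suc (suc (suc (suc (suc zero))))))) = 1ℤ        -- 111

-- Writing |γ⟩ = (a, b, c, d), the column K|000⟩ = (a, 0, b, 1, c, 0, d, 1) has norm 1 exactly when
-- a² + b² + c² + d² ≡ −1 (mod k).  Conversely such a, b, c, d complete it to an 8 × 8 matrix built
-- from quaternion multiplication tables and ±1 entries, whose Gram matrix is
-- (a² + b² + c² + d² + 2) I ≡ I (mod k).  That −1 is a sum of four squares modulo every k is
-- classical: for an odd prime p the p + 1 residues x² and −1 − y² (0 ≤ x, y ≤ (p − 1)/2) cannot be
-- pairwise distinct; solutions modulo coprime moduli combine by the Chinese remainder theorem, and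
-- lift from p^e to p^(e+1) (from 2^e to 2^(e+1) once e ≥ 3) by rescaling.
module Submission where

open import Defs
open import Data.Nat as ℕ using (ℕ; zero; suc; _≥_; s≤s; NonZero)
import Data.Nat.Properties as ℕ
open import Data.Nat.Divisibility as ℕ using (>⇒∤)
open import Data.Nat.Coprimality using (Coprime; coprime-Bézout)
open import Data.Nat.GCD using (module Bézout)
open import Data.Nat.DivMod using (m≡m%n+[m/n]*n; m%n<n)
open import Data.Nat.ListAction using (product)
open import Data.Nat.Primality using (Prime; euclidsLemma; prime⇒irreducible)
open import Data.Nat.Primality.Factorisation using (factorise; PrimeFactorisation)
open import Data.Fin using (Fin; zero; suc; toℕ; fromℕ<; splitAt; join)
open import Data.Fin.Properties
  using (pigeonhole; all?; toℕ-injective; toℕ-fromℕ<; toℕ≤pred[n]; join-splitAt; <⇒≢)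
open import Data.Integer
  using (ℤ; +_; -_; _+_; _-_; _*_; 0ℤ; 1ℤ; ∣_∣; _%ℕ_; _/ℕ_)
open import Data.Integer.Properties
  using (pos-+; pos-*; abs-*; +-comm; +-inverseʳ; i-j≡0⇒i≡j; ∣i∣≡0⇒i≡0; [+m]-[+n]≡m⊖n; ∣m⊝n∣≤m⊔n; +-injective)
open import Data.Integer.DivMod using (n%ℕd<d; a≡a%ℕn+[a/ℕn]*n)
open import Data.Integer.Divisibility.Signed using (_∣_; divides; quotient; ∣-trans; ∣m⇒∣m*n; ∣⇒∣ᵤ; ∣ᵤ⇒∣)
open import Data.Integer.Tactic.RingSolver using (ring; solve-∀)
open import Data.List.Relation.Unary.All using (All; []; _∷_)
open import Data.Product using (Σ; ∃₂; _×_; _,_)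
open import Data.Sum using (inj₁; inj₂; [_,_])
open import Data.Vec using (Vec; []; _∷_; lookup)
open import Function using (_∘_; Injective)
open import Relation.Binary.PropositionalEquality using (_≡_; _≢_; refl; sym; trans; cong; cong₂; subst; subst₂; module ≡-Reasoning)
open import Relation.Nullary using (yes; no; ¬_; contradiction)
open import Relation.Nullary.Decidable using (toWitness)
open import Tactic.RingSolver.Core.Expression using (Expr; Κ; Ι; _⊕_; _⊗_; ⊝_)
open import Tactic.RingSolver.Core.Polynomial.Parameters using (module Homomorphism)
open import Tactic.RingSolver.NonReflective ring using (module Ops)
open Ops using (⟦_⟧; norm; correct; homo)
open import Tactic.RingSolver.Core.Polynomial.Base (Homomorphism.from homo) using (Zero; zero?)
open import Tactic.RingSolver.Core.Polynomial.Homomorphism.Lemmas homo using (zero-hom)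

coprime⇒bézout : ∀ {m n} → Coprime m n → ∃₂ λ u v → u * + m + v * + n ≡ 1ℤ
coprime⇒bézout {m} {n} coprime with coprime-Bézout coprime
... | Bézout.+- x y eq = + x , - + y , (begin
      + x * + m + - + y * + n        ≡⟨ cong (_+ - + y * + n) (sym (cast x m y n eq)) ⟩
      1ℤ + + y * + n + - + y * + n   ≡⟨ cancel (+ y) (+ n) ⟩
      1ℤ                             ∎)
  where
  open ≡-Reasoning
  cancel : ∀ y n → 1ℤ + y * n + - y * n ≡ 1ℤ
  cancel = solve-∀
  cast : ∀ x m y n → 1 ℕ.+ y ℕ.* n ≡ x ℕ.* m → 1ℤ + + y * + n ≡ + x * + m
  cast x m y n eq =
    trans (cong (_+_ 1ℤ) (sym (pos-* y n))) (trans (cong +_ eq) (pos-* x m))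
... | Bézout.-+ x y eq = - + x , + y , (begin
      - + x * + m + + y * + n        ≡⟨ cong (_+_ (- + x * + m)) (sym (cast x m y n eq)) ⟩
      - + x * + m + (1ℤ + + x * + m) ≡⟨ cancel (+ x) (+ m) ⟩
      1ℤ                             ∎)
  where
  open ≡-Reasoning
  cancel : ∀ x m → - x * m + (1ℤ + x * m) ≡ 1ℤ
  cancel = solve-∀
  cast : ∀ x m y n → 1 ℕ.+ x ℕ.* m ≡ y ℕ.* n → 1ℤ + + x * + m ≡ + y * + n
  cast x m y n eq =
    trans (cong (_+_ 1ℤ) (sym (pos-* x m))) (trans (cong +_ eq) (pos-* y n))

prime∤⇒coprime : ∀ {p n} → Prime p → ¬ p ℕ.∣ n → Coprime p n
prime∤⇒coprime p-prime p∤n (d∣p , d∣n) with prime⇒irreducible p-prime d∣p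
... | inj₁ d≡1 = d≡1
... | inj₂ refl = contradiction d∣n p∤n

prime≢2⇒odd : ∀ {p} → Prime p → p ≢ 2 → Σ ℕ λ h → p ≡ suc (h ℕ.+ h)
prime≢2⇒odd {p} p-prime p≢2 with p ℕ.% 2 | m≡m%n+[m/n]*n p 2 | m%n<n p 2
... | 0 | p≡2h | _ with prime⇒irreducible p-prime (ℕ.divides (p ℕ./ 2) p≡2h)
...   | inj₁ ()
...   | inj₂ 2≡p = contradiction (sym 2≡p) p≢2
prime≢2⇒odd {p} p-prime p≢2 | 1 | p≡2h+1 | _ =
  p ℕ./ 2 , trans p≡2h+1 (cong suc (trans (ℕ.*-comm (p ℕ./ 2) 2) (cong (p ℕ./ 2 ℕ.+_) (ℕ.+-identityʳ _))))
prime≢2⇒odd {p} p-prime p≢2 | suc (suc _) | _ | s≤s (s≤s ())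

small-multiple≡0 : ∀ {p n} → p ℕ.∣ n → n ℕ.< p → n ≡ 0
small-multiple≡0 {n = zero} _ _ = refl
small-multiple≡0 {n = suc _} p∣n n<p = contradiction p∣n (>⇒∤ n<p)

squares-congruent⇒≡ : ∀ {p} x y → Prime p → x ℕ.+ y ℕ.< p → + p ∣ + x * + x - + y * + y → x ≡ y
squares-congruent⇒≡ {p} x y p-prime x+y<p p∣x²-y² with euclidsLemma ∣ + x - + y ∣ (x ℕ.+ y) p-prime p∣product
  where
  difference-of-squares : ∀ x y → x * x - y * y ≡ (x - y) * (x + y)
  difference-of-squares = solve-∀
  p∣product : p ℕ.∣ ∣ + x - + y ∣ ℕ.* (x ℕ.+ y)
  p∣product = subst (p ℕ.∣_) (abs-* (+ x - + y) (+ x + + y))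
                (∣⇒∣ᵤ (subst (+ p ∣_) (difference-of-squares (+ x) (+ y)) p∣x²-y²))
... | inj₁ p∣x-y = +-injective (i-j≡0⇒i≡j _ _ (∣i∣≡0⇒i≡0 (small-multiple≡0 p∣x-y ∣x-y∣<p)))
  where
  ∣x-y∣<p : ∣ + x - + y ∣ ℕ.< p
  ∣x-y∣<p = ℕ.≤-<-trans (ℕ.≤-trans (ℕ.≤-reflexive (cong ∣_∣ ([+m]-[+n]≡m⊖n x y)))
                                     (ℕ.≤-trans (∣m⊝n∣≤m⊔n x y) (ℕ.m⊔n≤m+n x y))) x+y<p
... | inj₂ p∣x+y = trans (ℕ.m+n≡0⇒m≡0 x x+y≡0) (sym (ℕ.m+n≡0⇒n≡0 x x+y≡0))
  where
  x+y≡0 : x ℕ.+ y ≡ 0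
  x+y≡0 = small-multiple≡0 p∣x+y x+y<p

module _ {p : ℕ} .{{_ : NonZero p}} where

  residue : ℤ → Fin p
  residue z = fromℕ< (n%ℕd<d z p)

  residue-≡⇒∣ : ∀ x y → residue x ≡ residue y → + p ∣ x - y
  residue-≡⇒∣ x y eq = divides (x /ℕ p - y /ℕ p) (begin
      x - y
        ≡⟨ cong₂ _-_ (a≡a%ℕn+[a/ℕn]*n x p) (a≡a%ℕn+[a/ℕn]*n y p) ⟩
      (+ (x %ℕ p) + x /ℕ p * + p) - (+ (y %ℕ p) + y /ℕ p * + p)
        ≡⟨ cong (λ r → (+ (x %ℕ p) + x /ℕ p * + p) - (+ r + y /ℕ p * + p)) (sym same-remainder) ⟩
      (+ (x %ℕ p) + x /ℕ p * + p) - (+ (x %ℕ p) + y /ℕ p * + p)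
        ≡⟨ cancel (+ (x %ℕ p)) (x /ℕ p) (y /ℕ p) (+ p) ⟩
      (x /ℕ p - y /ℕ p) * + p ∎)
    where
    open ≡-Reasoning
    same-remainder : x %ℕ p ≡ y %ℕ p
    same-remainder = trans (sym (toℕ-fromℕ< _)) (trans (cong toℕ eq) (toℕ-fromℕ< _))
    cancel : ∀ r q₁ q₂ p → (r + q₁ * p) - (r + q₂ * p) ≡ (q₁ - q₂) * p
    cancel = solve-∀

images-meet : ∀ {m n} (f g : Fin n → Fin m) → Injective _≡_ _≡_ f → Injective _≡_ _≡_ g →
              m ℕ.< n ℕ.+ n → ∃₂ λ i j → f i ≡ g j
images-meet {n = n} f g f-injective g-injective m<n+n with pigeonhole m<n+n ([ f , g ] ∘ splitAt n)
... | i , j , i<j , eq = meet (splitAt n i) (splitAt n j) (<⇒≢ i<j ∘ splitAt-injective) eq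
  where
  splitAt-injective : splitAt n i ≡ splitAt n j → i ≡ j
  splitAt-injective e = trans (sym (join-splitAt n n i)) (trans (cong (join n n) e) (join-splitAt n n j))
  meet : ∀ s t → s ≢ t → [ f , g ] s ≡ [ f , g ] t → ∃₂ λ i j → f i ≡ g j
  meet (inj₁ x) (inj₁ y) s≢t e = contradiction (cong inj₁ (f-injective e)) s≢t
  meet (inj₁ x) (inj₂ y) _   e = x , y , e
  meet (inj₂ x) (inj₁ y) _   e = y , x , sym e
  meet (inj₂ x) (inj₂ y) s≢t e = contradiction (cong inj₂ (g-injective e)) s≢t

record MinusOneSumOfFourSquaresMod (m : ℤ) : Set where
  constructor fourSquares
  field
    a b c d : ℤ
    divides-sum+1 : m ∣ a * a + b * b + c * c + d * d + 1ℤ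

open MinusOneSumOfFourSquaresMod using (divides-sum+1)

divisor-closed : ∀ {m n} → n ∣ m → MinusOneSumOfFourSquaresMod m → MinusOneSumOfFourSquaresMod n
divisor-closed n∣m (fourSquares a b c d m∣) = fourSquares a b c d (∣-trans n∣m m∣)

minusOne-mod-8 : MinusOneSumOfFourSquaresMod (+ 8)
minusOne-mod-8 = fourSquares 1ℤ 1ℤ 1ℤ (+ 2) (divides 1ℤ refl)

rescale : ∀ {m n} (u : ℤ) (S : MinusOneSumOfFourSquaresMod m) →
          n ∣ u * u * (quotient (divides-sum+1 S) * m - 1ℤ) + 1ℤ → MinusOneSumOfFourSquaresMod n
rescale {n = n} u (fourSquares a b c d (divides t eq)) n∣ =
  fourSquares (u * a) (u * b) (u * c) (u * d)
    (subst (n ∣_) (sym (trans (scaled-sum u a b c d) (cong (λ s → u * u * (s - 1ℤ) + 1ℤ) eq))) n∣)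
  where
  scaled-sum : ∀ u a b c d →
    (u * a) * (u * a) + (u * b) * (u * b) + (u * c) * (u * c) + (u * d) * (u * d) + 1ℤ
      ≡ u * u * ((a * a + b * b + c * c + d * d + 1ℤ) - 1ℤ) + 1ℤ
  scaled-sum = solve-∀

-- If a² + b² + c² + d² + 1 = t M, rescaling by u = 1 + M w gives M (t − 2 w) modulo M², and
-- w = t (r + 1) makes t − 2 w divisible by 2r + 1.
lift-odd : ∀ {M} r → (1ℤ + + 2 * r) ∣ M →
           MinusOneSumOfFourSquaresMod M → MinusOneSumOfFourSquaresMod (M * (1ℤ + + 2 * r))
lift-odd r (divides s refl) S = rescale (1ℤ + M * w) S (divides T (lifting-identity r s t))
  where
  q = 1ℤ + + 2 * r
  M = s * q
  t = quotient (divides-sum+1 S)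
  w = t * (r + 1ℤ)
  T = - t + s * (+ 2 * w * t + M * w * w * t - w * w)
  lifting-identity : ∀ r s t →
    (1ℤ + s * (1ℤ + + 2 * r) * (t * (r + 1ℤ))) * (1ℤ + s * (1ℤ + + 2 * r) * (t * (r + 1ℤ)))
      * (t * (s * (1ℤ + + 2 * r)) - 1ℤ) + 1ℤ
    ≡ (- t + s * (+ 2 * (t * (r + 1ℤ)) * t
                  + s * (1ℤ + + 2 * r) * (t * (r + 1ℤ)) * (t * (r + 1ℤ)) * t
                  - (t * (r + 1ℤ)) * (t * (r + 1ℤ))))
      * (s * (1ℤ + + 2 * r) * (1ℤ + + 2 * r))
  lifting-identity = solve-∀

-- The factor 1 + 4 m t is 1 + (M/2) t for the modulus M = 8 m: this is why the moduli carry a factor 8.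
lift-two : ∀ m → MinusOneSumOfFourSquaresMod (+ 8 * m) → MinusOneSumOfFourSquaresMod (+ 8 * (+ 2 * m))
lift-two m S = rescale (1ℤ + + 4 * m * t) S (divides (+ 3 * m * t * t + + 8 * m * m * t * t * t) (lifting-identity m t))
  where
  t = quotient (divides-sum+1 S)
  lifting-identity : ∀ m t →
    (1ℤ + + 4 * m * t) * (1ℤ + + 4 * m * t) * (t * (+ 8 * m) - 1ℤ) + 1ℤ
      ≡ (+ 3 * m * t * t + + 8 * m * m * t * t * t) * (+ 8 * (+ 2 * m))
  lifting-identity = solve-∀

-- With e₁ = v B ≡ 1 (mod A) and e₂ = u A ≡ 1 (mod B), combine the vectors as e₁ x₁ + e₂ x₂;
-- the constant 1 becomes (e₁ + e₂)².
chineseRemainder : ∀ {A B} u v → u * A + v * B ≡ 1ℤ →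
                   MinusOneSumOfFourSquaresMod A → MinusOneSumOfFourSquaresMod B →
                   MinusOneSumOfFourSquaresMod (A * B)
chineseRemainder {A} {B} u v bézout (fourSquares a₁ b₁ c₁ d₁ (divides t₁ eq₁)) (fourSquares a₂ b₂ c₂ d₂ (divides t₂ eq₂)) =
  fourSquares (a₁ * e₁ + a₂ * e₂) (b₁ * e₁ + b₂ * e₂) (c₁ * e₁ + c₂ * e₂) (d₁ * e₁ + d₂ * e₂)
    (divides (v * v * B * t₁ + u * u * A * t₂ + + 2 * u * v * X) (begin
      sum + 1ℤ
        ≡⟨ cong (λ e → sum + e * e) (sym (trans (+-comm e₁ e₂) bézout)) ⟩
      sum + (e₁ + e₂) * (e₁ + e₂)
        ≡⟨ expand a₁ b₁ c₁ d₁ a₂ b₂ c₂ d₂ e₁ e₂ ⟩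
      e₁ * e₁ * (a₁ * a₁ + b₁ * b₁ + c₁ * c₁ + d₁ * d₁ + 1ℤ)
        + e₂ * e₂ * (a₂ * a₂ + b₂ * b₂ + c₂ * c₂ + d₂ * d₂ + 1ℤ) + + 2 * e₁ * e₂ * X
        ≡⟨ cong₂ (λ N₁ N₂ → e₁ * e₁ * N₁ + e₂ * e₂ * N₂ + + 2 * e₁ * e₂ * X) eq₁ eq₂ ⟩
      v * B * (v * B) * (t₁ * A) + u * A * (u * A) * (t₂ * B) + + 2 * (v * B) * (u * A) * X
        ≡⟨ collect u v A B t₁ t₂ X ⟩
      (v * v * B * t₁ + u * u * A * t₂ + + 2 * u * v * X) * (A * B) ∎))
  where
  open ≡-Reasoning
  e₁ = v * B
  e₂ = u * A
  X = a₁ * a₂ + b₁ * b₂ + c₁ * c₂ + d₁ * d₂ + 1ℤ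
  sum = (a₁ * e₁ + a₂ * e₂) * (a₁ * e₁ + a₂ * e₂) + (b₁ * e₁ + b₂ * e₂) * (b₁ * e₁ + b₂ * e₂)
      + (c₁ * e₁ + c₂ * e₂) * (c₁ * e₁ + c₂ * e₂) + (d₁ * e₁ + d₂ * e₂) * (d₁ * e₁ + d₂ * e₂)
  expand : ∀ a₁ b₁ c₁ d₁ a₂ b₂ c₂ d₂ e₁ e₂ →
    (a₁ * e₁ + a₂ * e₂) * (a₁ * e₁ + a₂ * e₂) + (b₁ * e₁ + b₂ * e₂) * (b₁ * e₁ + b₂ * e₂)
    + (c₁ * e₁ + c₂ * e₂) * (c₁ * e₁ + c₂ * e₂) + (d₁ * e₁ + d₂ * e₂) * (d₁ * e₁ + d₂ * e₂)
    + (e₁ + e₂) * (e₁ + e₂)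
    ≡ e₁ * e₁ * (a₁ * a₁ + b₁ * b₁ + c₁ * c₁ + d₁ * d₁ + 1ℤ)
      + e₂ * e₂ * (a₂ * a₂ + b₂ * b₂ + c₂ * c₂ + d₂ * d₂ + 1ℤ)
      + + 2 * e₁ * e₂ * (a₁ * a₂ + b₁ * b₂ + c₁ * c₂ + d₁ * d₂ + 1ℤ)
  expand = solve-∀
  collect : ∀ u v A B t₁ t₂ X →
    v * B * (v * B) * (t₁ * A) + u * A * (u * A) * (t₂ * B) + + 2 * (v * B) * (u * A) * X
      ≡ (v * v * B * t₁ + u * u * A * t₂ + + 2 * u * v * X) * (A * B)
  collect = solve-∀

minusOne-mod-oddPrime : ∀ {h} → Prime (suc (h ℕ.+ h)) → MinusOneSumOfFourSquaresMod (+ suc (h ℕ.+ h))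
minusOne-mod-oddPrime {h} p-prime =
  fromCollision (images-meet square minusOneMinusSquare square-injective minusOneMinusSquare-injective p<h+1+h+1)
  where
  p = suc (h ℕ.+ h)
  sq : Fin (suc h) → ℤ
  sq x = + toℕ x * + toℕ x
  square minusOneMinusSquare : Fin (suc h) → Fin p
  square x = residue (sq x)
  minusOneMinusSquare y = residue (- (1ℤ + sq y))
  sum<p : ∀ (x y : Fin (suc h)) → toℕ x ℕ.+ toℕ y ℕ.< p
  sum<p x y = s≤s (ℕ.+-mono-≤ (toℕ≤pred[n] x) (toℕ≤pred[n] y))
  square-injective : Injective _≡_ _≡_ square
  square-injective {x} {y} e =
    toℕ-injective (squares-congruent⇒≡ _ _ p-prime (sum<p x y) (residue-≡⇒∣ (sq x) (sq y) e))
  negation-swaps : ∀ x y → - (1ℤ + x * x) - - (1ℤ + y * y) ≡ y * y - x * x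
  negation-swaps = solve-∀
  minusOneMinusSquare-injective : Injective _≡_ _≡_ minusOneMinusSquare
  minusOneMinusSquare-injective {x} {y} e = sym (toℕ-injective (squares-congruent⇒≡ _ _ p-prime (sum<p y x)
    (subst (+ p ∣_) (negation-swaps (+ toℕ x) (+ toℕ y)) (residue-≡⇒∣ (- (1ℤ + sq x)) (- (1ℤ + sq y)) e))))
  p<h+1+h+1 : p ℕ.< suc h ℕ.+ suc h
  p<h+1+h+1 = s≤s (ℕ.≤-reflexive (sym (ℕ.+-suc h h)))
  rearrange : ∀ x y → x * x - - (1ℤ + y * y) ≡ x * x + y * y + 0ℤ * 0ℤ + 0ℤ * 0ℤ + 1ℤ
  rearrange = solve-∀
  fromCollision : ∃₂ (λ x y → square x ≡ minusOneMinusSquare y) → MinusOneSumOfFourSquaresMod (+ p)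
  fromCollision (x , y , eq) = fourSquares (+ toℕ x) (+ toℕ y) 0ℤ 0ℤ
    (subst (+ p ∣_) (rearrange (+ toℕ x) (+ toℕ y)) (residue-≡⇒∣ (sq x) (- (1ℤ + sq y)) eq))

extend-by-prime : ∀ {p m} → Prime p →
                  MinusOneSumOfFourSquaresMod (+ 8 * + m) → MinusOneSumOfFourSquaresMod (+ 8 * + (p ℕ.* m))
extend-by-prime {p} {m} p-prime S with p ℕ.≟ 2
... | yes refl = subst (λ n → MinusOneSumOfFourSquaresMod (+ 8 * n)) (sym (pos-* 2 m)) (lift-two (+ m) S)
... | no p≢2 with prime≢2⇒odd p-prime p≢2
...   | h , refl with p ℕ.∣? 8 ℕ.* m
...     | yes p∣8m = subst MinusOneSumOfFourSquaresMod (sym (trans (cong (+ 8 *_) 8[p*m]) (reorder (1ℤ + + 2 * + h) (+ m))))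
                       (lift-odd (+ h) (subst₂ _∣_ odd (pos-* 8 m) (∣ᵤ⇒∣ p∣8m)) S)
  where
  odd : + suc (h ℕ.+ h) ≡ 1ℤ + + 2 * + h
  odd = trans (pos-+ 1 (h ℕ.+ h)) (cong (_+_ 1ℤ) (trans (pos-+ h h) (double (+ h))))
    where
    double : ∀ h → h + h ≡ + 2 * h
    double = solve-∀
  8[p*m] : + (suc (h ℕ.+ h) ℕ.* m) ≡ (1ℤ + + 2 * + h) * + m
  8[p*m] = trans (pos-* (suc (h ℕ.+ h)) m) (cong (_* + m) odd)
  reorder : ∀ q m → + 8 * (q * m) ≡ + 8 * m * q
  reorder = solve-∀
...     | no p∤8m with coprime⇒bézout (prime∤⇒coprime p-prime p∤8m)
...       | u , v , bézout = subst MinusOneSumOfFourSquaresMod (sym (trans (cong (+ 8 *_) (pos-* p m)) (reorder (+ p) (+ m))))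
                               (chineseRemainder u v (subst (λ n → u * + p + v * n ≡ 1ℤ) (pos-* 8 m) bézout)
                                  (minusOne-mod-oddPrime {h} p-prime) S)
  where
  reorder : ∀ p m → + 8 * (p * m) ≡ p * (+ 8 * m)
  reorder = solve-∀

minusOne-mod-8*product : ∀ {ps} → All Prime ps → MinusOneSumOfFourSquaresMod (+ 8 * + product ps)
minusOne-mod-8*product []                   = minusOne-mod-8
minusOne-mod-8*product (p-prime ∷ ps-prime) = extend-by-prime p-prime (minusOne-mod-8*product ps-prime)

minusOne-mod : ∀ k .{{_ : NonZero k}} → MinusOneSumOfFourSquaresMod (+ k)
minusOne-mod k = divisor-closed (divides (+ 8) refl)
  (subst (λ n → MinusOneSumOfFourSquaresMod (+ 8 * + n)) (sym isFactorisation)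
     (minusOne-mod-8*product factorsPrime))
  where open PrimeFactorisation (factorise k)

≡⇒≡[mod] : ∀ {x y} k → x ≡ y → x ≡[mod k ] y
≡⇒≡[mod] {x} k refl = ∣⇒∣ᵤ {k = + k} (divides 0ℤ (+-inverseʳ x))

gram≡[1+μ]I⇒unitary : ∀ {k n} (M : Mat n) μ → + k ∣ μ →
                      (∀ i j → ∑ n (λ l → M l i * M l j) ≡ (1ℤ + μ) * δ i j) → Unitary k n M
gram≡[1+μ]I⇒unitary {k} M μ k∣μ gram i j =
  ∣⇒∣ᵤ {k = + k} (subst (+ k ∣_) (sym (trans (cong (_- δ i j) (gram i j)) (shift μ (δ i j)))) (∣m⇒∣m*n (δ i j) k∣μ))
  where
  shift : ∀ μ e → (1ℤ + μ) * e - e ≡ μ * e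
  shift = solve-∀

∑ₑ : ∀ {m} (n : ℕ) → (Fin n → Expr ℤ m) → Expr ℤ m
∑ₑ zero    f = Κ 0ℤ
∑ₑ (suc n) f = f zero ⊕ ∑ₑ n (f ∘ suc)

⟦∑ₑ⟧ : ∀ {m} n (f : Fin n → Expr ℤ m) ρ → ⟦ ∑ₑ n f ⟧ ρ ≡ ∑ n (λ i → ⟦ f i ⟧ ρ)
⟦∑ₑ⟧ zero    f ρ = refl
⟦∑ₑ⟧ (suc n) f ρ = cong (_+_ (⟦ f zero ⟧ ρ)) (⟦∑ₑ⟧ n (f ∘ suc) ρ)

norm[e₁-e₂]≡0⇒⟦e₁⟧≡⟦e₂⟧ : ∀ {n} (e₁ e₂ : Expr ℤ n) → Zero (norm (e₁ ⊕ ⊝ e₂)) → ∀ ρ → ⟦ e₁ ⟧ ρ ≡ ⟦ e₂ ⟧ ρ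
norm[e₁-e₂]≡0⇒⟦e₁⟧≡⟦e₂⟧ e₁ e₂ zero-difference ρ = i-j≡0⇒i≡j _ _
  (trans (sym (correct (e₁ ⊕ ⊝ e₂) ρ)) (sym (zero-hom (norm (e₁ ⊕ ⊝ e₂)) zero-difference ρ)))

A B C D 𝟙 𝟘 -𝟙 : Expr ℤ 4
A = Ι zero
B = Ι (suc zero)
C = Ι (suc (suc zero))
D = Ι (suc (suc (suc zero)))
𝟙 = Κ 1ℤ
𝟘 = Κ 0ℤ
-𝟙 = Κ (- 1ℤ)

-- The even and the odd coordinates each carry a quaternion multiplication table in a, b, c, d;
-- the ±1 entries couple the two halves and add 2 to every column norm.
Kₑ : Fin 8 → Fin 8 → Expr ℤ 4
Kₑ i j = lookup (lookup rows i) j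
  where
  rows : Vec (Vec (Expr ℤ 4) 8) 8
  rows =
    (A   ∷ 𝟘   ∷ ⊝ B ∷ -𝟙  ∷ ⊝ C ∷ 𝟘   ∷ ⊝ D ∷ -𝟙  ∷ []) ∷
    (𝟘   ∷ A   ∷ 𝟘   ∷ ⊝ C ∷ 𝟙   ∷ B   ∷ 𝟙   ∷ ⊝ D ∷ []) ∷
    (B   ∷ 𝟘   ∷ A   ∷ 𝟙   ∷ ⊝ D ∷ 𝟘   ∷ C   ∷ -𝟙  ∷ []) ∷
    (𝟙   ∷ C   ∷ -𝟙  ∷ A   ∷ 𝟘   ∷ D   ∷ 𝟘   ∷ B   ∷ []) ∷
    (C   ∷ -𝟙  ∷ D   ∷ 𝟘   ∷ A   ∷ 𝟙   ∷ ⊝ B ∷ 𝟘   ∷ []) ∷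
    (𝟘   ∷ ⊝ B ∷ 𝟘   ∷ ⊝ D ∷ -𝟙  ∷ A   ∷ 𝟙   ∷ C   ∷ []) ∷
    (D   ∷ -𝟙  ∷ ⊝ C ∷ 𝟘   ∷ B   ∷ -𝟙  ∷ A   ∷ 𝟘   ∷ []) ∷
    (𝟙   ∷ D   ∷ 𝟙   ∷ ⊝ B ∷ 𝟘   ∷ ⊝ C ∷ 𝟘   ∷ A   ∷ []) ∷ []

K : ℤ → ℤ → ℤ → ℤ → Mat 8
K a b c d i j = ⟦ Kₑ i j ⟧ (a ∷ b ∷ c ∷ d ∷ [])

gramₑ : Fin 8 → Fin 8 → Expr ℤ 4
gramₑ i j = ∑ₑ 8 (λ l → Kₑ l i ⊗ Kₑ l j)

scaleₑ : Expr ℤ 4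
scaleₑ = 𝟙 ⊕ (A ⊗ A ⊕ B ⊗ B ⊕ C ⊗ C ⊕ D ⊗ D ⊕ 𝟙)

-- A closed computation on normal forms, decided for all 64 entries at once.
gramₑ-normalises : ∀ i j → Zero (norm (gramₑ i j ⊕ ⊝ (scaleₑ ⊗ Κ (δ i j))))
gramₑ-normalises = toWitness {a? = all? λ i → all? λ j → zero? (norm (gramₑ i j ⊕ ⊝ (scaleₑ ⊗ Κ (δ i j))))} _

K-gram : ∀ a b c d i j →
         ∑ 8 (λ l → K a b c d l i * K a b c d l j) ≡ (1ℤ + (a * a + b * b + c * c + d * d + 1ℤ)) * δ i j
K-gram a b c d i j = trans (sym (⟦∑ₑ⟧ 8 (λ l → Kₑ l i ⊗ Kₑ l j) ρ))
  (norm[e₁-e₂]≡0⇒⟦e₁⟧≡⟦e₂⟧ (gramₑ i j) (scaleₑ ⊗ Κ (δ i j)) (gramₑ-normalises i j) ρ)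
  where ρ = a ∷ b ∷ c ∷ d ∷ []

γ : ℤ → ℤ → ℤ → ℤ → Vec' 4
γ a b c d zero                   = a
γ a b c d (suc zero)             = b
γ a b c d (suc (suc zero))       = c
γ a b c d (suc (suc (suc zero))) = d

K-first-column : ∀ a b c d i → K a b c d i zero ≡ target (γ a b c d) i
K-first-column a b c d zero                                           = refl
K-first-column a b c d (suc zero)                                     = refl
K-first-column a b c d (suc (suc zero))                               = refl
K-first-column a b c d (suc (suc (suc zero)))                         = refl
K-first-column a b c d (suc (suc (suc (suc zero))))                   = refl
K-first-column a b c d (suc (suc (suc (suc (suc zero)))))             = refl
K-first-column a b c d (suc (suc (suc (suc (suc (suc zero))))))       = refl
K-first-column a b c d (suc (suc (suc (suc (suc (suc (suc zero))))))) = refl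

mainTheorem6 : (k : ℕ) → k ≥ 2 →
    Σ (Mat 8) (λ K → Unitary k 8 K ×
      Σ (Vec' 4) (λ γ → (i : Fin 8) → K i zero ≡[mod k ] target γ i))
mainTheorem6 k@(suc _) _ with minusOne-mod k
... | fourSquares a b c d k∣sum+1 =
  K a b c d , gram≡[1+μ]I⇒unitary (K a b c d) _ k∣sum+1 (K-gram a b c d) ,
  γ a b c d , λ i → ≡⇒≡[mod] k (K-first-column a b c d i)
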